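{- Let $i,j$ be positive integers. If the phylogeny graph of an $(i,j)$ digraph contains an induced subgraph isomorphic to $K_{m,n}$ for some positive integers $m,n$, then $m \leq j+1$ and $n \leq j+1$, and the equalities $m=j+1$ and $n=j+1$ do not hold simultaneously. Furthermore, if $i \neq 1$, then $K_{j+1,j}$ is $(i,j)$ realizable, i.e. it is isomorphic to an induced subgraph of the phylogeny graph of some $(i,j)$ digraph.
   Context: An $(i,j)$ digraph is an acyclic digraph in which every vertex has indegree at most $i$ and outdegree at most $j$. The phylogeny graph $P(D)$ has vertex set $V(D)$ and an edge between distinct $u,v$ iff $(u,v)\in A(D)$ or $(v,u)\in A(D)$ or $u,v$ have a common out-neighbor in $D$. $K_{m,n}$ is the complete bipartite graph with parts of sizes $m$ and $n$. -}

module Defs where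

open import Data.Nat using (ℕ; zero; suc; _+_; _≤_)
open import Data.Fin using (Fin)
open import Data.Bool using (Bool; true; false; T; if_then_else_)
open import Data.List using (List; map)
open import Data.Nat.ListAction using (sum)
open import Data.Unit using (⊤)
open import Data.List.Base using (allFin)
open import Data.Sum using (_⊎_; inj₁; inj₂)
open import Data.Product using (_×_; Σ; ∃)
open import Data.Empty using (⊥)
open import Relation.Nullary using (¬_)
open import Relation.Binary.PropositionalEquality using (_≡_; _≢_)
open import Function.Bundles using (_⇔_)
open import Function.Definitions using (Injective)

record Digraph : Set where
  field
    N   : ℕ
    arc : Fin N → Fin N → Bool
open Digraph public

Arc : (D : Digraph) → Fin (N D) → Fin (N D) → Set
Arc D u v = T (arc D u v)

data Reach (D : Digraph) : Fin (N D) → Fin (N D) → Set where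
  step : ∀ {u v} → Arc D u v → Reach D u v
  _∷_  : ∀ {u v w} → Arc D u v → Reach D v w → Reach D u w

Acyclic : Digraph → Set
Acyclic D = ∀ v → ¬ Reach D v v

indeg : (D : Digraph) → Fin (N D) → ℕ
indeg D v = sum (map (λ u → if arc D u v then 1 else 0) (allFin (N D)))

outdeg : (D : Digraph) → Fin (N D) → ℕ
outdeg D u = sum (map (λ v → if arc D u v then 1 else 0) (allFin (N D)))

IJDigraph : ℕ → ℕ → Digraph → Set
IJDigraph i j D = Acyclic D × (∀ v → indeg D v ≤ i) × (∀ v → outdeg D v ≤ j)

PhyloAdj : (D : Digraph) → Fin (N D) → Fin (N D) → Set
PhyloAdj D u v =
  u ≢ v × (Arc D u v ⊎ Arc D v u ⊎ ∃ λ w → Arc D u w × Arc D v w)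

KAdj : ∀ {m n} → Fin m ⊎ Fin n → Fin m ⊎ Fin n → Set
KAdj (inj₁ _) (inj₁ _) = ⊥
KAdj (inj₁ _) (inj₂ _) = ⊤
KAdj (inj₂ _) (inj₁ _) = ⊤
KAdj (inj₂ _) (inj₂ _) = ⊥

InducedKmn : (D : Digraph) → ℕ → ℕ → Set
InducedKmn D m n =
  Σ (Fin m ⊎ Fin n → Fin (N D)) λ f →
    Injective _≡_ _≡_ f ×
    (∀ x y → x ≢ y → (PhyloAdj D (f x) (f y) ⇔ KAdj x y))

Realizable : ℕ → ℕ → ℕ → ℕ → Set
Realizable i j m n = Σ Digraph λ D → IJDigraph i j D × InducedKmn D m n

{-# OPTIONS --safe #-}
-- Two distinct vertices are adjacent in P(D) exactly when they have a common closed
-- out-neighbour (a vertex equal to, or reached by an arc from, each of them). Fix a vertex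
-- b of one part of an induced K_{m,n}. The common closed out-neighbours of b and of the m
-- vertices of the other part are pairwise distinct, because those vertices are pairwise
-- non-adjacent, and they lie in {b} ∪ N⁺(b); so m ≤ 1 + j, and even m ≤ j unless one of the
-- m vertices is an in-neighbour of b. If m = n = j + 1, every vertex of the K_{m,n} thus has
-- an in-neighbour in it, and walking backwards closes a cycle.
-- For realizability take vertices a₀, …, a_j, b_k and c_{k,l} (k, l < j) with arcs
-- a₀ → b_k, a_{l+1} → c_{k,l} and b_k → c_{k,l}: a₀ meets b_k directly, a_{l+1} meets b_k at
-- c_{k,l}, no two a's and no two b's share an out-neighbour, and only the c's have in-degree 2.
module Submission where

open import Defs
open import Algebra.Properties.CommutativeSemigroup using (interchange)
open import Data.Bool using (Bool; true; false; T; if_then_else_; _∨_)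
open import Data.Bool.Properties using (T-∨)
open import Data.Empty using (⊥-elim)
open import Data.Fin using (Fin; zero; suc; punchIn; punchOut; _≟_; toℕ)
open import Data.Fin.Properties
  using (any?; pigeonhole; suc-injective; punchIn-punchOut; punchOut-injective; +↔⊎; *↔×)
open import Data.List using (map; tabulate)
open import Data.List.Base using (allFin)
open import Data.List.Properties using (map-tabulate)
open import Data.Nat using (ℕ; zero; suc; _+_; _*_; _≤_; _<_; z≤n; s≤s)
open import Data.Nat.ListAction using (sum)
open import Data.Nat.Properties using
  ( +-suc; +-comm; +-mono-≤; +-commutativeSemigroup; ≤-refl; ≤-reflexive; ≤-trans; <-irrefl; <-trans
  ; <⇒≱; ≤∧≢⇒<; n<1+n; m≤n⇒∃[o]m+o≡n; module ≤-Reasoning )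
open import Data.Product using (_×_; _,_; ∃; proj₁; proj₂)
open import Data.Sum using (_⊎_; inj₁; inj₂; swap)
open import Data.Sum.Function.Propositional using (_⊎-↔_)
open import Data.Sum.Properties using (inj₁-injective)
open import Data.Unit using (tt)
open import Function using (_∘_; id; case_of_)
open import Function.Bundles using (_⇔_; _↔_; mk⇔; Equivalence; Inverse)
open import Function.Construct.Composition using (_⇔-∘_; _↔-∘_)
open import Function.Construct.Identity using (↔-id)
open import Function.Definitions using (Injective)
open import Relation.Binary.Definitions using (Decidable)
open import Relation.Binary.PropositionalEquality
open import Relation.Nullary using (¬_; yes; no)
open import Relation.Nullary.Decidable using (⌊_⌋; map′; toWitness; fromWitness; T?)

count : ∀ {n} → (Fin n → Bool) → ℕ
count {zero}  P = 0
count {suc n} P = (if P zero then 1 else 0) + count (P ∘ suc)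

sum-allFin≡count : ∀ {n} (P : Fin n → Bool) →
  sum (map (λ v → if P v then 1 else 0) (allFin n)) ≡ count P
sum-allFin≡count {n} P = trans (cong sum (map-tabulate id (λ v → if P v then 1 else 0))) (sum-tabulate P)
  where
  sum-tabulate : ∀ {n} (P : Fin n → Bool) → sum (tabulate (λ v → if P v then 1 else 0)) ≡ count P
  sum-tabulate {zero}  P = refl
  sum-tabulate {suc n} P = cong ((if P zero then 1 else 0) +_) (sum-tabulate (P ∘ suc))

outdeg≡count : ∀ D u → outdeg D u ≡ count (arc D u)
outdeg≡count D u = sum-allFin≡count (arc D u)

indeg≡count : ∀ D v → indeg D v ≡ count (λ u → arc D u v)
indeg≡count D v = sum-allFin≡count (λ u → arc D u v)

count-true : ∀ n → count {n} (λ _ → true) ≡ n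
count-true zero    = refl
count-true (suc n) = cong suc (count-true n)

count-∨ : ∀ {n} (P Q : Fin n → Bool) → count (λ v → P v ∨ Q v) ≤ count P + count Q
count-∨ {zero}  P Q = z≤n
count-∨ {suc n} P Q = begin
  ind (P zero ∨ Q zero) + count (λ v → P (suc v) ∨ Q (suc v))
    ≤⟨ +-mono-≤ (ind-∨ (P zero) (Q zero)) (count-∨ (P ∘ suc) (Q ∘ suc)) ⟩
  (ind (P zero) + ind (Q zero)) + (count (P ∘ suc) + count (Q ∘ suc))
    ≡⟨ interchange +-commutativeSemigroup (ind (P zero)) (ind (Q zero)) (count (P ∘ suc)) (count (Q ∘ suc)) ⟩
  count P + count Q ∎
  where
  open ≤-Reasoning
  ind : Bool → ℕ
  ind b = if b then 1 else 0
  ind-∨ : ∀ b c → ind (b ∨ c) ≤ ind b + ind c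
  ind-∨ true  c = s≤s z≤n
  ind-∨ false c = ≤-refl

count-punchIn : ∀ {n} (Q : Fin (suc n) → Bool) q → T (Q q) → count Q ≡ suc (count (Q ∘ punchIn q))
count-punchIn Q zero Qq = cong (_+ count (Q ∘ suc)) (T⇒if≡1 Qq)
  where
  T⇒if≡1 : ∀ {b} → T b → (if b then 1 else 0) ≡ 1
  T⇒if≡1 {true} _ = refl
count-punchIn {suc n} Q (suc q) Qq =
  trans (cong ((if Q zero then 1 else 0) +_) (count-punchIn (Q ∘ suc) q Qq))
        (+-suc (if Q zero then 1 else 0) (count (Q ∘ suc ∘ punchIn q)))

count-≤-injection : ∀ {m n} (P : Fin m → Bool) (Q : Fin n → Bool) (h : ∀ v → T (P v) → Fin n) →
  (∀ v p → T (Q (h v p))) → (∀ v w p q → h v p ≡ h w q → v ≡ w) → count P ≤ count Q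
count-≤-injection {zero} P Q h hQ h-inj = z≤n
count-≤-injection {suc m} P Q h hQ h-inj with P zero in eq
... | false = count-≤-injection (P ∘ suc) Q (h ∘ suc) (hQ ∘ suc) (λ v w p q → suc-injective ∘ h-inj (suc v) (suc w) p q)
... | true  = remove Q (h ∘ suc) (h zero p₀) (hQ zero p₀) (hQ ∘ suc)
                (λ v p e → case h-inj zero (suc v) p₀ p (sym e) of λ ())
                (λ v w p q → suc-injective ∘ h-inj (suc v) (suc w) p q)
  where
  p₀ : T (P zero)
  p₀ = subst T (sym eq) tt
  remove : ∀ {n} (Q : Fin n → Bool) (h : ∀ v → T (P (suc v)) → Fin n) q → T (Q q) →
    (∀ v p → T (Q (h v p))) → (∀ v p → h v p ≢ q) → (∀ v w p p′ → h v p ≡ h w p′ → v ≡ w) →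
    suc (count (P ∘ suc)) ≤ count Q
  remove {suc n} Q h q Qq hQ h≢q h-inj = subst (suc (count (P ∘ suc)) ≤_) (sym (count-punchIn Q q Qq))
    (s≤s (count-≤-injection (P ∘ suc) (Q ∘ punchIn q)
      (λ v p → punchOut (h≢q v p ∘ sym))
      (λ v p → subst (T ∘ Q) (sym (punchIn-punchOut (h≢q v p ∘ sym))) (hQ v p))
      (λ v w p p′ → h-inj v w p p′ ∘ punchOut-injective (h≢q v p ∘ sym) (h≢q w p′ ∘ sym))))

injective⇒≤count : ∀ {m n} (Q : Fin n → Bool) (g : Fin m → Fin n) →
  Injective _≡_ _≡_ g → (∀ k → T (Q (g k))) → m ≤ count Q
injective⇒≤count {m} Q g g-inj Qg = subst (_≤ count Q) (count-true m)
  (count-≤-injection (λ _ → true) Q (λ k _ → g k) (λ k _ → Qg k) (λ _ _ _ _ → g-inj))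

injective⇒count≤ : ∀ {n k} (P : Fin n → Bool) (h : ∀ v → T (P v) → Fin k) →
  (∀ v w p q → h v p ≡ h w q → v ≡ w) → count P ≤ k
injective⇒count≤ {k = k} P h h-inj = subst (count P ≤_) (count-true k)
  (count-≤-injection P (λ _ → true) h (λ _ _ → tt) h-inj)

module _ (D : Digraph) where

  ClosedOutNbr : Fin (N D) → Fin (N D) → Set
  ClosedOutNbr x w = x ≡ w ⊎ Arc D x w

  closedOutNbr? : Fin (N D) → Fin (N D) → Bool
  closedOutNbr? x w = ⌊ x ≟ w ⌋ ∨ arc D x w

  closedOutNbr⇒T : ∀ {x w} → ClosedOutNbr x w → T (closedOutNbr? x w)
  closedOutNbr⇒T {x} {w} (inj₁ x≡w) = Equivalence.from (T-∨ {⌊ x ≟ w ⌋}) (inj₁ (fromWitness x≡w))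
  closedOutNbr⇒T {x} {w} (inj₂ x⇒w) = Equivalence.from (T-∨ {⌊ x ≟ w ⌋}) (inj₂ x⇒w)

  count-closedOutNbr : ∀ x → count (closedOutNbr? x) ≤ suc (outdeg D x)
  count-closedOutNbr x = begin
    count (closedOutNbr? x)                  ≤⟨ count-∨ (λ w → ⌊ x ≟ w ⌋) (arc D x) ⟩
    count (λ w → ⌊ x ≟ w ⌋) + count (arc D x) ≤⟨ +-mono-≤ count-self (≤-reflexive (sym (outdeg≡count D x))) ⟩
    suc (outdeg D x)                         ∎
    where
    open ≤-Reasoning
    count-self : count (λ w → ⌊ x ≟ w ⌋) ≤ 1
    count-self = injective⇒count≤ (λ w → ⌊ x ≟ w ⌋) (λ _ _ → zero)
      (λ _ _ p q _ → trans (sym (toWitness p)) (toWitness q))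

  phyloAdj⇒commonClosedOutNbr : ∀ {x y} → PhyloAdj D x y → ∃ λ w → ClosedOutNbr x w × ClosedOutNbr y w
  phyloAdj⇒commonClosedOutNbr {y = y} (_ , inj₁ x⇒y)                 = y , inj₂ x⇒y , inj₁ refl
  phyloAdj⇒commonClosedOutNbr {x = x} (_ , inj₂ (inj₁ y⇒x))          = x , inj₁ refl , inj₂ y⇒x
  phyloAdj⇒commonClosedOutNbr (_ , inj₂ (inj₂ (w , x⇒w , y⇒w))) = w , inj₂ x⇒w , inj₂ y⇒w

  commonClosedOutNbr⇒phyloAdj : ∀ {x y w} → x ≢ y → ClosedOutNbr x w → ClosedOutNbr y w → PhyloAdj D x y
  commonClosedOutNbr⇒phyloAdj x≢y (inj₁ refl) (inj₁ refl) = ⊥-elim (x≢y refl)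
  commonClosedOutNbr⇒phyloAdj x≢y (inj₁ refl) (inj₂ y⇒x)  = x≢y , inj₂ (inj₁ y⇒x)
  commonClosedOutNbr⇒phyloAdj x≢y (inj₂ x⇒y)  (inj₁ refl) = x≢y , inj₁ x⇒y
  commonClosedOutNbr⇒phyloAdj x≢y (inj₂ x⇒w)  (inj₂ y⇒w)  = x≢y , inj₂ (inj₂ (_ , x⇒w , y⇒w))

module _ (D : Digraph) {b : Fin (N D)} {m : ℕ} (u : Fin m → Fin (N D)) (u-injective : Injective _≡_ _≡_ u)
  (adjacent : ∀ k → PhyloAdj D (u k) b) (independent : ∀ k k′ → k ≢ k′ → ¬ PhyloAdj D (u k) (u k′)) where

  private
    meet : ∀ k → ∃ λ w → ClosedOutNbr D (u k) w × ClosedOutNbr D b w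
    meet k = phyloAdj⇒commonClosedOutNbr D (adjacent k)

    meet-injective : Injective _≡_ _≡_ (proj₁ ∘ meet)
    meet-injective {k} {k′} eq with k ≟ k′
    ... | yes k≡k′ = k≡k′
    ... | no  k≢k′ = ⊥-elim (independent k k′ k≢k′ (commonClosedOutNbr⇒phyloAdj D (k≢k′ ∘ u-injective)
          (proj₁ (proj₂ (meet k))) (subst (ClosedOutNbr D (u k′)) (sym eq) (proj₁ (proj₂ (meet k′))))))

  independentNbrs≤1+outdeg : m ≤ suc (outdeg D b)
  independentNbrs≤1+outdeg = ≤-trans
    (injective⇒≤count (closedOutNbr? D b) (proj₁ ∘ meet) meet-injective
      (closedOutNbr⇒T D ∘ proj₂ ∘ proj₂ ∘ meet))
    (count-closedOutNbr D b)

  -- The meeting point of u k and b can only be b itself if u k ⇒ b.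
  independentNbrs≤outdeg : (∀ k → ¬ Arc D (u k) b) → m ≤ outdeg D b
  independentNbrs≤outdeg no-arc = subst (m ≤_) (sym (outdeg≡count D b))
    (injective⇒≤count (arc D b) (proj₁ ∘ meet) meet-injective out-nbr)
    where
    out-nbr : ∀ k → T (arc D b (proj₁ (meet k)))
    out-nbr k with meet k
    ... | _ , _           , inj₂ b⇒w = b⇒w
    ... | _ , inj₁ refl   , inj₁ refl = ⊥-elim (proj₁ (adjacent k) refl)
    ... | _ , inj₂ u⇒b    , inj₁ refl = ⊥-elim (no-arc k u⇒b)

InducedKmn-swap : ∀ D {m n} → InducedKmn D m n → InducedKmn D n m
InducedKmn-swap D (f , f-injective , f-adj) =
  f ∘ swap , swap-injective ∘ f-injective , λ x y x≢y → adj x y (x≢y ∘ swap-injective)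
  where
  swap-injective : ∀ {A B : Set} {x y : A ⊎ B} → swap x ≡ swap y → x ≡ y
  swap-injective {x = inj₁ _} {inj₁ _} refl = refl
  swap-injective {x = inj₂ _} {inj₂ _} refl = refl
  adj : ∀ x y → swap x ≢ swap y → PhyloAdj D (f (swap x)) (f (swap y)) ⇔ KAdj x y
  adj (inj₁ _) (inj₁ _) = f-adj _ _
  adj (inj₁ _) (inj₂ _) = f-adj _ _
  adj (inj₂ _) (inj₁ _) = f-adj _ _
  adj (inj₂ _) (inj₂ _) = f-adj _ _

module _ (D : Digraph) {m n : ℕ} (e : InducedKmn D m n) (b : Fin n) where

  private
    f : Fin m ⊎ Fin n → Fin (N D)
    f = proj₁ e

    left : Fin m → Fin (N D)
    left = f ∘ inj₁

    left-injective : Injective _≡_ _≡_ left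
    left-injective = inj₁-injective ∘ proj₁ (proj₂ e)

    adjacent : ∀ k → PhyloAdj D (left k) (f (inj₂ b))
    adjacent k = Equivalence.from (proj₂ (proj₂ e) (inj₁ k) (inj₂ b) λ ()) tt

    independent : ∀ k k′ → k ≢ k′ → ¬ PhyloAdj D (left k) (left k′)
    independent k k′ k≢k′ = Equivalence.to (proj₂ (proj₂ e) (inj₁ k) (inj₁ k′) (k≢k′ ∘ inj₁-injective))

  left≤1+outdeg : m ≤ suc (outdeg D (proj₁ e (inj₂ b)))
  left≤1+outdeg = independentNbrs≤1+outdeg D left left-injective adjacent independent

  left-contains-inNbr : outdeg D (proj₁ e (inj₂ b)) < m → ∃ λ k → Arc D (proj₁ e (inj₁ k)) (proj₁ e (inj₂ b))
  left-contains-inNbr outdeg<m with any? (λ k → T? (arc D (left k) (f (inj₂ b))))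
  ... | yes found = found
  ... | no  none  = ⊥-elim (<⇒≱ outdeg<m
          (independentNbrs≤outdeg D left left-injective adjacent independent (λ k a → none (k , a))))

module _ {D : Digraph} {S : Set} (f : S → Fin (N D)) (pred : S → S) (pred⇒ : ∀ x → Arc D (f (pred x)) (f x)) where

  private
    iterate : ℕ → S → S
    iterate zero    = id
    iterate (suc t) = pred ∘ iterate t

    walk : ∀ t s z → Reach D (f (iterate (t + suc s) z)) (f (iterate s z))
    walk zero    s z = step (pred⇒ (iterate s z))
    walk (suc t) s z = pred⇒ (iterate (t + suc s) z) ∷ walk t s z

  predecessors⇒¬acyclic : S → ¬ Acyclic D
  predecessors⇒¬acyclic x₀ acyclic with pigeonhole (n<1+n (N D)) (λ k → f (iterate (toℕ k) x₀))
  ... | k , k′ , k<k′ , fk≡fk′ with m≤n⇒∃[o]m+o≡n k<k′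
  ... | d , 1+k+d≡k′ = acyclic (f (iterate (toℕ k) x₀))
    (subst (λ t → Reach D t (f (iterate (toℕ k) x₀)))
      (trans (cong (λ t → f (iterate t x₀)) (trans (+-comm d _) 1+k+d≡k′)) (sym fk≡fk′))
      (walk d (toℕ k) x₀))

left≤1+j : ∀ {i j D m n} → IJDigraph i j D → InducedKmn D m (suc n) → m ≤ suc j
left≤1+j {D = D} (_ , _ , outdeg≤j) e = ≤-trans (left≤1+outdeg D e zero) (s≤s (outdeg≤j _))

¬InducedK[1+j,1+j] : ∀ {i j D} → IJDigraph i j D → ¬ InducedKmn D (suc j) (suc j)
¬InducedK[1+j,1+j] {i} {j} {D} (acyclic , _ , outdeg≤j) e =
  predecessors⇒¬acyclic (proj₁ e) pred pred⇒ (inj₁ zero) acyclic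
  where
  inNbr : (e : InducedKmn D (suc j) (suc j)) → ∀ b → ∃ λ k → Arc D (proj₁ e (inj₁ k)) (proj₁ e (inj₂ b))
  inNbr e b = left-contains-inNbr D e b (s≤s (outdeg≤j _))
  pred : Fin (suc j) ⊎ Fin (suc j) → Fin (suc j) ⊎ Fin (suc j)
  pred (inj₁ a) = inj₂ (proj₁ (inNbr (InducedKmn-swap D e) a))
  pred (inj₂ b) = inj₁ (proj₁ (inNbr e b))
  pred⇒ : ∀ x → Arc D (proj₁ e (pred x)) (proj₁ e x)
  pred⇒ (inj₁ a) = proj₂ (inNbr (InducedKmn-swap D e) a)
  pred⇒ (inj₂ b) = proj₂ (inNbr e b)

module EnumeratedDigraph {V : Set} {n : ℕ} (enum : Fin n ↔ V) (_⇒_ : V → V → Set) (_⇒?_ : Decidable _⇒_) where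

  open Inverse enum renaming (to to vertex; from to index)

  digraph : Digraph
  digraph = record { N = n ; arc = λ u v → ⌊ vertex u ⇒? vertex v ⌋ }

  vertex-injective : Injective _≡_ _≡_ vertex
  vertex-injective {u} {v} eq = trans (sym (strictlyInverseʳ u)) (trans (cong index eq) (strictlyInverseʳ v))

  index-injective : Injective _≡_ _≡_ index
  index-injective {x} {y} eq = trans (sym (strictlyInverseˡ x)) (trans (cong vertex eq) (strictlyInverseˡ y))

  arc⇒ : ∀ {u v} → Arc digraph u v → vertex u ⇒ vertex v
  arc⇒ = toWitness

  ⇒arc : ∀ {x y} → x ⇒ y → Arc digraph (index x) (index y)
  ⇒arc {x} {y} x⇒y = fromWitness (subst₂ _⇒_ (sym (strictlyInverseˡ x)) (sym (strictlyInverseˡ y)) x⇒y)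

  acyclic : (rank : V → ℕ) → (∀ {x y} → x ⇒ y → rank x < rank y) → Acyclic digraph
  acyclic rank rank-< _ cycle = <-irrefl refl (reach-< cycle)
    where
    reach-< : ∀ {u v} → Reach digraph u v → rank (vertex u) < rank (vertex v)
    reach-< (step u⇒v)  = rank-< (arc⇒ u⇒v)
    reach-< (u⇒w ∷ w⇝v) = <-trans (rank-< (arc⇒ u⇒w)) (reach-< w⇝v)

  outdeg≤ : ∀ {k} (label : ∀ {x y} → x ⇒ y → Fin k) →
    (∀ {x y y′} (p : x ⇒ y) (q : x ⇒ y′) → label p ≡ label q → y ≡ y′) → ∀ u → outdeg digraph u ≤ k
  outdeg≤ label label-injective u = subst (_≤ _) (sym (outdeg≡count digraph u))
    (injective⇒count≤ (arc digraph u) (λ _ p → label (arc⇒ p))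
      (λ _ _ p q → vertex-injective ∘ label-injective (arc⇒ p) (arc⇒ q)))

  indeg≤ : ∀ {k} (label : ∀ {x y} → x ⇒ y → Fin k) →
    (∀ {x x′ y} (p : x ⇒ y) (q : x′ ⇒ y) → label p ≡ label q → x ≡ x′) → ∀ v → indeg digraph v ≤ k
  indeg≤ label label-injective v = subst (_≤ _) (sym (indeg≡count digraph v))
    (injective⇒count≤ (λ u → arc digraph u v) (λ _ p → label (arc⇒ p))
      (λ _ _ p q → vertex-injective ∘ label-injective (arc⇒ p) (arc⇒ q)))

  Related : V → V → Set
  Related x y = x ⇒ y ⊎ y ⇒ x ⊎ ∃ λ z → x ⇒ z × y ⇒ z

  Related-sym : ∀ {x y} → Related x y → Related y x
  Related-sym (inj₁ x⇒y)                 = inj₂ (inj₁ x⇒y)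
  Related-sym (inj₂ (inj₁ y⇒x))          = inj₁ y⇒x
  Related-sym (inj₂ (inj₂ (z , x⇒z , y⇒z))) = inj₂ (inj₂ (z , y⇒z , x⇒z))

  phyloAdj⇒Related : ∀ {u v} → PhyloAdj digraph u v → Related (vertex u) (vertex v)
  phyloAdj⇒Related (_ , inj₁ u⇒v)                    = inj₁ (arc⇒ u⇒v)
  phyloAdj⇒Related (_ , inj₂ (inj₁ v⇒u))             = inj₂ (inj₁ (arc⇒ v⇒u))
  phyloAdj⇒Related (_ , inj₂ (inj₂ (w , u⇒w , v⇒w))) = inj₂ (inj₂ (vertex w , arc⇒ u⇒w , arc⇒ v⇒w))

  Related⇒phyloAdj : ∀ {x y} → x ≢ y → Related x y → PhyloAdj digraph (index x) (index y)
  Related⇒phyloAdj x≢y (inj₁ x⇒y)                    = x≢y ∘ index-injective , inj₁ (⇒arc x⇒y)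
  Related⇒phyloAdj x≢y (inj₂ (inj₁ y⇒x))             = x≢y ∘ index-injective , inj₂ (inj₁ (⇒arc y⇒x))
  Related⇒phyloAdj x≢y (inj₂ (inj₂ (z , x⇒z , y⇒z))) =
    x≢y ∘ index-injective , inj₂ (inj₂ (index z , ⇒arc x⇒z , ⇒arc y⇒z))

  phyloAdj⇔Related : ∀ {x y} → x ≢ y → PhyloAdj digraph (index x) (index y) ⇔ Related x y
  phyloAdj⇔Related {x} {y} x≢y = mk⇔
    (subst₂ Related (strictlyInverseˡ x) (strictlyInverseˡ y) ∘ phyloAdj⇒Related)
    (Related⇒phyloAdj x≢y)

  inducedKmn : ∀ {m m′} (ι : Fin m ⊎ Fin m′ → V) → Injective _≡_ _≡_ ι →
    (∀ x y → x ≢ y → Related (ι x) (ι y) ⇔ KAdj x y) → InducedKmn digraph m m′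
  inducedKmn ι ι-injective ι-adj = index ∘ ι , ι-injective ∘ index-injective ,
    λ x y x≢y → ι-adj x y x≢y ⇔-∘ phyloAdj⇔Related (x≢y ∘ ι-injective)

module Construction (j : ℕ) where

  V : Set
  V = Fin (suc j) ⊎ Fin j ⊎ Fin j × Fin j

  pattern a l   = inj₁ l
  pattern b k   = inj₂ (inj₁ k)
  pattern c k l = inj₂ (inj₂ (k , l))

  enumeration : Fin (suc j + (j + j * j)) ↔ V
  enumeration = (↔-id _ ⊎-↔ ((↔-id _ ⊎-↔ *↔×) ↔-∘ +↔⊎)) ↔-∘ +↔⊎

  data _⇒_ : V → V → Set where
    a₀⇒b : ∀ {k}   → a zero ⇒ b k
    a⇒c  : ∀ {k l} → a (suc l) ⇒ c k l
    b⇒c  : ∀ {k l} → b k ⇒ c k l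

  _⇒?_ : Decidable _⇒_
  a zero    ⇒? a _    = no λ ()
  a zero    ⇒? b _    = yes a₀⇒b
  a zero    ⇒? c _ _  = no λ ()
  a (suc l) ⇒? a _    = no λ ()
  a (suc l) ⇒? b _    = no λ ()
  a (suc l) ⇒? c _ l′ = map′ (λ { refl → a⇒c }) (λ { a⇒c → refl }) (l ≟ l′)
  b k       ⇒? a _    = no λ ()
  b k       ⇒? b _    = no λ ()
  b k       ⇒? c k′ _ = map′ (λ { refl → b⇒c }) (λ { b⇒c → refl }) (k ≟ k′)
  c _ _     ⇒? _      = no λ ()

  open EnumeratedDigraph enumeration _⇒_ _⇒?_

  rank : V → ℕ
  rank (a _)   = 0
  rank (b _)   = 1
  rank (c _ _) = 2

  rank-< : ∀ {x y} → x ⇒ y → rank x < rank y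
  rank-< a₀⇒b = s≤s z≤n
  rank-< a⇒c  = s≤s z≤n
  rank-< b⇒c  = s≤s (s≤s z≤n)

  out-label : ∀ {x y} → x ⇒ y → Fin j
  out-label (a₀⇒b {k})   = k
  out-label (a⇒c {k})    = k
  out-label (b⇒c {l = l}) = l

  out-label-injective : ∀ {x y y′} (p : x ⇒ y) (q : x ⇒ y′) → out-label p ≡ out-label q → y ≡ y′
  out-label-injective a₀⇒b a₀⇒b refl = refl
  out-label-injective a⇒c  a⇒c  refl = refl
  out-label-injective b⇒c  b⇒c  refl = refl

  in-label : ∀ {x y} → x ⇒ y → Fin 2
  in-label a₀⇒b = zero
  in-label a⇒c  = zero
  in-label b⇒c  = suc zero

  in-label-injective : ∀ {x x′ y} (p : x ⇒ y) (q : x′ ⇒ y) → in-label p ≡ in-label q → x ≡ x′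
  in-label-injective a₀⇒b a₀⇒b refl = refl
  in-label-injective a⇒c  a⇒c  refl = refl
  in-label-injective b⇒c  b⇒c  refl = refl

  ι : Fin (suc j) ⊎ Fin j → V
  ι (inj₁ l) = a l
  ι (inj₂ k) = b k

  ι-injective : Injective _≡_ _≡_ ι
  ι-injective {inj₁ _} {inj₁ _} refl = refl
  ι-injective {inj₂ _} {inj₂ _} refl = refl

  a-independent : ∀ {l l′} → Related (a l) (a l′) → l ≡ l′
  a-independent (inj₂ (inj₂ (_ , a₀⇒b , a₀⇒b))) = refl
  a-independent (inj₂ (inj₂ (_ , a⇒c  , a⇒c)))  = refl

  b-independent : ∀ {k k′} → Related (b k) (b k′) → k ≡ k′
  b-independent (inj₂ (inj₂ (_ , b⇒c , b⇒c))) = refl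

  a-b-related : ∀ l k → Related (a l) (b k)
  a-b-related zero    k = inj₁ a₀⇒b
  a-b-related (suc l) k = inj₂ (inj₂ (c k l , a⇒c , b⇒c))

  ι-adjacency : ∀ x y → x ≢ y → Related (ι x) (ι y) ⇔ KAdj x y
  ι-adjacency (inj₁ l) (inj₁ l′) x≢y = mk⇔ (λ r → x≢y (cong inj₁ (a-independent r))) λ ()
  ι-adjacency (inj₁ l) (inj₂ k)  _   = mk⇔ _ λ _ → a-b-related l k
  ι-adjacency (inj₂ k) (inj₁ l)  _   = mk⇔ _ λ _ → Related-sym (a-b-related l k)
  ι-adjacency (inj₂ k) (inj₂ k′) x≢y = mk⇔ (λ r → x≢y (cong inj₂ (b-independent r))) λ ()

  realizable : ∀ {i} → 2 ≤ i → Realizable i j (suc j) j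
  realizable 2≤i =
    digraph ,
    (acyclic rank rank-< , (λ v → ≤-trans (indeg≤ in-label in-label-injective v) 2≤i) ,
      outdeg≤ out-label out-label-injective) ,
    inducedKmn ι ι-injective ι-adjacency

proposition3p4 : (i j : ℕ) → 1 ≤ i → 1 ≤ j →
    ((m n : ℕ) → 1 ≤ m → 1 ≤ n → (D : Digraph) → IJDigraph i j D → InducedKmn D m n →
      m ≤ suc j × n ≤ suc j × ¬ (m ≡ suc j × n ≡ suc j))
    × (i ≢ 1 → Realizable i j (suc j) j)
proposition3p4 i j 1≤i _ = bounds , λ i≢1 → Construction.realizable j (≤∧≢⇒< 1≤i (≢-sym i≢1))
  where
  bounds : (m n : ℕ) → 1 ≤ m → 1 ≤ n → (D : Digraph) → IJDigraph i j D → InducedKmn D m n →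
    m ≤ suc j × n ≤ suc j × ¬ (m ≡ suc j × n ≡ suc j)
  bounds (suc m) (suc n) _ _ D ij e =
    left≤1+j ij e , left≤1+j ij (InducedKmn-swap D e) , λ { (refl , refl) → ¬InducedK[1+j,1+j] ij e }
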